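{- For every closed base type $A$, the iso $\mathrm{Dup}_A^\emptyset$ is well-defined, and $\vdash_\omega\mathrm{Dup}_A^\emptyset:A\leftrightarrow A\otimes A$.
   Context: The language has base types $A ::= \mathbb{1}\mid A\oplus B\mid A\otimes B\mid\mu X.A\mid X$, values $v::=()\mid x\mid \mathtt{inl}\,v\mid\mathtt{inr}\,v\mid\langle v_1,v_2\rangle\mid \mathtt{fold}\,v$, expressions $e::=v\mid\mathtt{let}\,p_1=\omega\,p_2\,\mathtt{in}\,e$, and isos $\omega::=\{v_1\leftrightarrow e_1\mid\dots\mid v_n\leftrightarrow e_n\}\mid\mathtt{fix}\,\phi.\omega\mid\lambda\phi.\omega\mid\phi\mid\omega_1\omega_2$, typed as follows: a clause-set $\{v_i\leftrightarrow e_i\}$ has type $A\leftrightarrow B$ if each $v_i:A$ and $e_i:B$ in the same linear context of term variables, left-hand sides are pairwise orthogonal and right-hand sides pairwise orthogonal ($\perp$: smallest relation with $\mathtt{inl}\,t_1\perp\mathtt{inr}\,t_2$, $\mathtt{inr}\,t_1\perp\mathtt{inl}\,t_2$, closed under $\mathtt{inl},\mathtt{inr},\mathtt{fold}$, pairing with a term, and $\mathtt{let}$ bodies); $\mathtt{fix}\,\phi.\omega:T$ if $\omega:T$ assuming $\phi:T$; $\mathtt{fold}\,t:\mu X.A$ if $t:A[\mu X.A/X]$; $\mathtt{let}\,(x_1,\dots)=\omega\,t\,\mathtt{in}\,e$ binds the components of the result of $\omega$ applied to $t$. Duplication: for a set $S$ of pairs (type variable $X$, iso variable $\phi$), $\mathrm{Dup}^S_A$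 is defined by induction on $A$: $\mathrm{Dup}^S_{\mathbb{1}}=\{()\leftrightarrow\langle(),()\rangle\}$; $\mathrm{Dup}^S_{A\otimes B}=\{\langle x,y\rangle\leftrightarrow\mathtt{let}\,\langle x_1,x_2\rangle=\mathrm{Dup}^S_A\,x\,\mathtt{in}\,\mathtt{let}\,\langle y_1,y_2\rangle=\mathrm{Dup}^S_B\,y\,\mathtt{in}\,\langle\langle x_1,y_1\rangle,\langle x_2,y_2\rangle\rangle\}$; $\mathrm{Dup}^S_{A\oplus B}=\{\mathtt{inl}\,x\leftrightarrow\mathtt{let}\,\langle x_1,x_2\rangle=\mathrm{Dup}^S_A\,x\,\mathtt{in}\,\langle\mathtt{inl}\,x_1,\mathtt{inl}\,x_2\rangle\mid\mathtt{inr}\,y\leftrightarrow\mathtt{let}\,\langle y_1,y_2\rangle=\mathrm{Dup}^S_B\,y\,\mathtt{in}\,\langle\mathtt{inr}\,y_1,\mathtt{inr}\,y_2\rangle\}$; if no pair $(X,\_)$ is in $S$: $\mathrm{Dup}^S_{\mu X.A}=\mathtt{fix}\,\phi.\{\mathtt{fold}\,x\leftrightarrow\mathtt{let}\,\langle x_1,x_2\rangle=\mathrm{Dup}^{S\cup\{(X,\phi)\}}_{A[\mu X.A/X]}\,x\,\mathtt{in}\,\langle\mathtt{fold}\,x_1,\mathtt{fold}\,x_2\rangle\}$ ($\phi$ fresh); if $(X,\phi)\in S$: $\mathrm{Dup}^S_{\mu X.A}=\{x\leftrightarrow\mathtt{let}\,\langle x_1,x_2\rangle=\phi\,x\,\mathtt{in}\,\langle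 x_1,x_2\rangle\}$. Bound variables are assumed distinct. -}

module Defs where

open import Data.Nat using (ℕ; suc; _+_; _≡ᵇ_)
open import Data.Bool using (if_then_else_)
open import Data.List using (List; []; _∷_; map)
open import Data.Product using (_×_; _,_; proj₁; proj₂)
open import Data.List.Relation.Unary.All using (All)
open import Data.List.Relation.Unary.Any using (Any)
open import Data.List.Relation.Unary.AllPairs using (AllPairs)
open import Data.List.Relation.Unary.Unique.Propositional using (Unique)
open import Data.List.Membership.Propositional using (_∈_)
open import Relation.Binary.PropositionalEquality using (_≡_; _≢_)
open import Relation.Nullary using (¬_)

infixr 6 _⊕_
infixr 7 _⊗_

data Ty : Set where
  𝟙    : Ty
  _⊕_  : Ty → Ty → Ty
  _⊗_  : Ty → Ty → Ty
  μ    : ℕ → Ty → Ty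
  tvar : ℕ → Ty

-- substitution A [ B / X ]  (only ever used with closed B, so no capture)
_[_/_] : Ty → Ty → ℕ → Ty
𝟙 [ B / X ] = 𝟙
(A₁ ⊕ A₂) [ B / X ] = (A₁ [ B / X ]) ⊕ (A₂ [ B / X ])
(A₁ ⊗ A₂) [ B / X ] = (A₁ [ B / X ]) ⊗ (A₂ [ B / X ])
μ Y A [ B / X ] = if Y ≡ᵇ X then μ Y A else μ Y (A [ B / X ])
tvar Y [ B / X ] = if Y ≡ᵇ X then B else tvar Y

data Scoped : List ℕ → Ty → Set where
  s𝟙 : ∀ {Γ} → Scoped Γ 𝟙
  s⊕ : ∀ {Γ A B} → Scoped Γ A → Scoped Γ B → Scoped Γ (A ⊕ B)
  s⊗ : ∀ {Γ A B} → Scoped Γ A → Scoped Γ B → Scoped Γ (A ⊗ B)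
  sμ : ∀ {Γ X A} → Scoped (X ∷ Γ) A → Scoped Γ (μ X A)
  svar : ∀ {Γ X} → X ∈ Γ → Scoped Γ (tvar X)

Closed : Ty → Set
Closed A = Scoped [] A

binders : Ty → List ℕ
binders 𝟙 = []
binders (A ⊕ B) = Data.List._++_ (binders A) (binders B)
binders (A ⊗ B) = Data.List._++_ (binders A) (binders B)
binders (μ X A) = X ∷ binders A
binders (tvar X) = []

DistinctBinders : Ty → Set
DistinctBinders A = Unique (binders A)

TermVar : Set
TermVar = ℕ

IsoVar : Set
IsoVar = ℕ

data Val : Set where
  unit : Val
  var  : TermVar → Val
  inl  : Val → Val
  inr  : Val → Val
  ⟨_,_⟩ : Val → Val → Val
  fold : Val → Val

data Pat : Set where
  pvar  : TermVar → Pat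
  ppair : Pat → Pat → Pat

patVal : Pat → Val
patVal (pvar x) = var x
patVal (ppair p q) = ⟨ patVal p , patVal q ⟩

mutual
  -- e ::= v | let p₁ = ω p₂ in e     (written  elet p₁ ω p₂ e)
  data Expr : Set where
    val  : Val → Expr
    elet : Pat → Iso → Pat → Expr → Expr

  data Iso : Set where
    clauses : List (Val × Expr) → Iso
    fix     : IsoVar → Iso → Iso
    lam     : IsoVar → Iso → Iso
    ivar    : IsoVar → Iso
    app     : Iso → Iso → Iso

infixr 4 _↔_
data ITy : Set where
  _↔_ : Ty → Ty → ITy
  _⇒_ : ITy → ITy → ITy

data _⊥v_ : Val → Val → Set where
  lr   : ∀ {t₁ t₂} → inl t₁ ⊥v inr t₂
  rl   : ∀ {t₁ t₂} → inr t₁ ⊥v inl t₂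
  cinl : ∀ {t₁ t₂} → t₁ ⊥v t₂ → inl t₁ ⊥v inl t₂
  cinr : ∀ {t₁ t₂} → t₁ ⊥v t₂ → inr t₁ ⊥v inr t₂
  cfold : ∀ {t₁ t₂} → t₁ ⊥v t₂ → fold t₁ ⊥v fold t₂
  cpairₗ : ∀ {t₁ t₂ t t'} → t₁ ⊥v t₂ → ⟨ t₁ , t ⟩ ⊥v ⟨ t₂ , t' ⟩
  cpairᵣ : ∀ {t₁ t₂ t t'} → t₁ ⊥v t₂ → ⟨ t , t₁ ⟩ ⊥v ⟨ t' , t₂ ⟩

data _⊥e_ : Expr → Expr → Set where
  cval : ∀ {v₁ v₂} → v₁ ⊥v v₂ → val v₁ ⊥e val v₂
  clet : ∀ {p ω t e₁ p' ω' t' e₂} → e₁ ⊥e e₂ →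
         elet p ω t e₁ ⊥e elet p' ω' t' e₂

Ctx : Set
Ctx = List (TermVar × Ty)

ICtx : Set
ICtx = List (IsoVar × ITy)

data Split {a} {X : Set a} : List X → List X → List X → Set a where
  []    : Split [] [] []
  left  : ∀ {x Δ Δ₁ Δ₂} → Split Δ Δ₁ Δ₂ → Split (x ∷ Δ) (x ∷ Δ₁) Δ₂
  right : ∀ {x Δ Δ₁ Δ₂} → Split Δ Δ₁ Δ₂ → Split (x ∷ Δ) Δ₁ (x ∷ Δ₂)

data _⊢v_∶_ : Ctx → Val → Ty → Set where
  tunit : [] ⊢v unit ∶ 𝟙
  tvarr : ∀ {x A} → ((x , A) ∷ []) ⊢v var x ∶ A
  tinl  : ∀ {Δ v A B} → Δ ⊢v v ∶ A → Δ ⊢v inl v ∶ (A ⊕ B)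
  tinr  : ∀ {Δ v A B} → Δ ⊢v v ∶ B → Δ ⊢v inr v ∶ (A ⊕ B)
  tpair : ∀ {Δ Δ₁ Δ₂ v₁ v₂ A B} → Split Δ Δ₁ Δ₂ →
          Δ₁ ⊢v v₁ ∶ A → Δ₂ ⊢v v₂ ∶ B → Δ ⊢v ⟨ v₁ , v₂ ⟩ ∶ (A ⊗ B)
  tfold : ∀ {Δ v X A} → Δ ⊢v v ∶ (A [ μ X A / X ]) → Δ ⊢v fold v ∶ μ X A

data Lookup : ICtx → IsoVar → ITy → Set where
  here  : ∀ {Ψ φ T} → Lookup ((φ , T) ∷ Ψ) φ T
  there : ∀ {Ψ φ φ' T T'} → φ ≢ φ' → Lookup Ψ φ T → Lookup ((φ' , T') ∷ Ψ) φ T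

mutual
  data _⨾_⊢e_∶_ (Ψ : ICtx) : Ctx → Expr → Ty → Set where
    tval : ∀ {Δ v A} → Δ ⊢v v ∶ A → Ψ ⨾ Δ ⊢e val v ∶ A
    tlet : ∀ {Δ Δ₁ Δ₂ Δp Δe p₁ p₂ ω e A B C} →
           Split Δ Δ₁ Δ₂ →
           Ψ ⊢ω ω ∶ (A ↔ B) →
           Δ₁ ⊢v patVal p₂ ∶ A →
           Δp ⊢v patVal p₁ ∶ B →
           Split Δe Δ₂ Δp →
           Unique (map proj₁ Δe) →
           Ψ ⨾ Δe ⊢e e ∶ C →
           Ψ ⨾ Δ ⊢e elet p₁ ω p₂ e ∶ C

  data ClauseTy (Ψ : ICtx) (A B : Ty) : Val × Expr → Set where
    tclause : ∀ {Δ v e} → Unique (map proj₁ Δ) →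
              Δ ⊢v v ∶ A → Ψ ⨾ Δ ⊢e e ∶ B → ClauseTy Ψ A B (v , e)

  data _⊢ω_∶_ : ICtx → Iso → ITy → Set where
    tclauses : ∀ {Ψ cs A B} →
               All (ClauseTy Ψ A B) cs →
               AllPairs _⊥v_ (map proj₁ cs) →
               AllPairs _⊥e_ (map proj₂ cs) →
               Ψ ⊢ω clauses cs ∶ (A ↔ B)
    tfix  : ∀ {Ψ φ ω T} → ((φ , T) ∷ Ψ) ⊢ω ω ∶ T → Ψ ⊢ω fix φ ω ∶ T
    tlam  : ∀ {Ψ φ ω T₁ T₂} → ((φ , T₁) ∷ Ψ) ⊢ω ω ∶ T₂ → Ψ ⊢ω lam φ ω ∶ (T₁ ⇒ T₂)
    tivar : ∀ {Ψ φ T} → Lookup Ψ φ T → Ψ ⊢ω ivar φ ∶ T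
    tapp  : ∀ {Ψ ω₁ ω₂ T₁ T₂} → Ψ ⊢ω ω₁ ∶ (T₁ ⇒ T₂) → Ψ ⊢ω ω₂ ∶ T₁ → Ψ ⊢ω app ω₁ ω₂ ∶ T₂

-- Duplication  Dup^S_A, as the graph of the (non-structural) recursive
-- definition.  Dup S A n ω m : "Dup^S_A = ω", where fresh variable names are
-- drawn from a counter starting at n and ending at m.

DupEnv : Set
DupEnv = List (ℕ × IsoVar)

data Dup : DupEnv → Ty → ℕ → Iso → ℕ → Set where
  d𝟙 : ∀ {S n} →
       Dup S 𝟙 n (clauses ((unit , val ⟨ unit , unit ⟩) ∷ [])) n
  d⊗ : ∀ {S A B n m k ωA ωB} →
       Dup S A (6 + n) ωA m → Dup S B m ωB k →
       let x = n ; y = 1 + n ; x₁ = 2 + n ; x₂ = 3 + n ; y₁ = 4 + n ; y₂ = 5 + n in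
       Dup S (A ⊗ B) n
         (clauses ((⟨ var x , var y ⟩ ,
                    elet (ppair (pvar x₁) (pvar x₂)) ωA (pvar x)
                     (elet (ppair (pvar y₁) (pvar y₂)) ωB (pvar y)
                       (val ⟨ ⟨ var x₁ , var y₁ ⟩ , ⟨ var x₂ , var y₂ ⟩ ⟩))) ∷ []))
         k
  d⊕ : ∀ {S A B n m k ωA ωB} →
       Dup S A (6 + n) ωA m → Dup S B m ωB k →
       let x = n ; x₁ = 1 + n ; x₂ = 2 + n ; y = 3 + n ; y₁ = 4 + n ; y₂ = 5 + n in
       Dup S (A ⊕ B) n
         (clauses ((inl (var x) ,
                    elet (ppair (pvar x₁) (pvar x₂)) ωA (pvar x)
                      (val ⟨ inl (var x₁) , inl (var x₂) ⟩)) ∷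
                   (inr (var y) ,
                    elet (ppair (pvar y₁) (pvar y₂)) ωB (pvar y)
                      (val ⟨ inr (var y₁) , inr (var y₂) ⟩)) ∷ []))
         k
  dμnew : ∀ {S X A n m ω} →
       ¬ Any (λ q → proj₁ q ≡ X) S →
       let φ = n ; x = 1 + n ; x₁ = 2 + n ; x₂ = 3 + n in
       Dup ((X , φ) ∷ S) (A [ μ X A / X ]) (4 + n) ω m →
       Dup S (μ X A) n
         (fix φ (clauses ((fold (var x) ,
                   elet (ppair (pvar x₁) (pvar x₂)) ω (pvar x)
                     (val ⟨ fold (var x₁) , fold (var x₂) ⟩)) ∷ [])))
         m
  dμold : ∀ {S X A n φ} →
       (X , φ) ∈ S →
       let x = n ; x₁ = 1 + n ; x₂ = 2 + n in
       Dup S (μ X A) n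
         (clauses ((var x ,
                   elet (ppair (pvar x₁) (pvar x₂)) (ivar φ) (pvar x)
                     (val ⟨ var x₁ , var x₂ ⟩)) ∷ []))
         (3 + n)

-- The recursion defining Dup is not structural: it unfolds μX.A to A[μX.A/X].
-- But once μX.A is unfolded, X is recorded in S, so every copy of μX.A that the
-- substitution created is answered at once by the iso variable of X; as binders
-- are distinct, the remaining binders are never shadowed.  Hence the recursion
-- follows the syntax tree of A: we generalise to D ⟪ σ ⟫, the type D under the
-- sequence σ of unfoldings performed so far, and recurse on D.  Each generated
-- clause-set is well typed once its recursive calls are, with the iso variable of
-- an unfolded μX.A typed μX.A ↔ μX.A ⊗ μX.A (iso variables are drawn in
-- increasing order, so the lookup of that variable is never shadowed).  Finally
-- Dup is deterministic as long as S binds each type variable at most once.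
module Submission where

open import Defs
open import Data.Nat using (ℕ; _+_; _≤_; _<_; _≡ᵇ_; _≟_)
open import Data.Nat.Properties using (≡ᵇ⇒≡; ≡⇒≡ᵇ; ≤-refl; ≤-trans; m≤n+m; <⇒≢; +-cancelʳ-≡)
open import Data.Bool using (true; false)
open import Data.List using (List; []; _∷_; map; _++_)
open import Data.List.Properties using (++-identityʳ)
open import Data.Product using (Σ; _×_; _,_; proj₁; uncurry)
open import Data.Empty using (⊥-elim)
open import Function using (_∘_)
open import Data.List.Relation.Unary.All as All using (All; []; _∷_)
import Data.List.Relation.Unary.All.Properties as All
open import Data.List.Relation.Unary.Any as Any using (Any; here; there)
open import Data.List.Relation.Unary.AllPairs using ([]; _∷_)
open import Data.List.Relation.Unary.Unique.Propositional using (Unique)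
open import Data.List.Membership.Propositional using (_∈_; _∉_)
open import Data.List.Membership.DecPropositional _≟_ using (_∈?_)
open import Data.List.Membership.Propositional.Properties using (∈-map⁺)
open import Data.List.Relation.Binary.Subset.Propositional using (_⊆_)
open import Data.List.Relation.Binary.Permutation.Propositional.Properties using (∈-resp-↭; shift)
open import Relation.Binary.PropositionalEquality using (_≡_; _≢_; refl; sym; trans; cong; cong₂; subst)
open import Relation.Nullary using (¬_; yes; no)

private
  variable
    Γ Δ : List ℕ
    S : DupEnv
    Ψ : ICtx
    A B D E : Ty
    X Y : ℕ
    φ : IsoVar
    n m : ℕ

Unique-++⁻ : ∀ (xs : List ℕ) {ys} → Unique (xs ++ ys) → Unique xs × Unique ys
Unique-++⁻ []       u       = [] , u
Unique-++⁻ (x ∷ xs) (p ∷ u) =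
  let uxs , uys = Unique-++⁻ xs u in All.++⁻ˡ xs p ∷ uxs , uys

∉-∷ : ∀ {Z} {ks : List ℕ} → Y ≢ Z → Z ∉ ks → Z ∉ Y ∷ ks
∉-∷ Y≢Z Z∉ks (here Z≡Y)  = Y≢Z (sym Z≡Y)
∉-∷ Y≢Z Z∉ks (there Z∈ks) = Z∉ks Z∈ks

offset-≢ : ∀ a b → a ≢ b → a + n ≢ b + n
offset-≢ {n} a b a≢b = a≢b ∘ +-cancelʳ-≡ n a b

≡⇒≡ᵇ-true : X ≡ Y → (X ≡ᵇ Y) ≡ true
≡⇒≡ᵇ-true {X} {Y} X≡Y with X ≡ᵇ Y | ≡⇒≡ᵇ X Y X≡Y
... | true | _ = refl

≢⇒≡ᵇ-false : X ≢ Y → (X ≡ᵇ Y) ≡ false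
≢⇒≡ᵇ-false {X} {Y} X≢Y with X ≡ᵇ Y | ≡ᵇ⇒≡ X Y
... | true  | ≡ᵇ⇒X≡Y = ⊥-elim (X≢Y (≡ᵇ⇒X≡Y _))
... | false | _       = refl

[/]-μ-shadowed : Y ≡ X → μ Y A [ B / X ] ≡ μ Y A
[/]-μ-shadowed {Y} {X} Y≡X rewrite ≡⇒≡ᵇ-true Y≡X = refl

[/]-μ : Y ≢ X → μ Y A [ B / X ] ≡ μ Y (A [ B / X ])
[/]-μ {Y} {X} Y≢X rewrite ≢⇒≡ᵇ-false Y≢X = refl

[/]-tvar-hit : Y ≡ X → tvar Y [ B / X ] ≡ B
[/]-tvar-hit {Y} {X} Y≡X rewrite ≡⇒≡ᵇ-true Y≡X = refl

[/]-tvar-miss : Y ≢ X → tvar Y [ B / X ] ≡ tvar Y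
[/]-tvar-miss {Y} {X} Y≢X rewrite ≢⇒≡ᵇ-false Y≢X = refl

Scoped-weaken : Γ ⊆ Δ → Scoped Γ A → Scoped Δ A
Scoped-weaken Γ⊆Δ s𝟙         = s𝟙
Scoped-weaken Γ⊆Δ (s⊕ sA sB) = s⊕ (Scoped-weaken Γ⊆Δ sA) (Scoped-weaken Γ⊆Δ sB)
Scoped-weaken Γ⊆Δ (s⊗ sA sB) = s⊗ (Scoped-weaken Γ⊆Δ sA) (Scoped-weaken Γ⊆Δ sB)
Scoped-weaken Γ⊆Δ (sμ sA)    = sμ (Scoped-weaken (λ { (here e) → here e ; (there m) → there (Γ⊆Δ m) }) sA)
Scoped-weaken Γ⊆Δ (svar X∈Γ) = svar (Γ⊆Δ X∈Γ)

[/]-unused : Scoped Γ A → X ∉ Γ → A [ B / X ] ≡ A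
[/]-unused s𝟙 X∉Γ = refl
[/]-unused (s⊕ sA sB) X∉Γ = cong₂ _⊕_ ([/]-unused sA X∉Γ) ([/]-unused sB X∉Γ)
[/]-unused (s⊗ sA sB) X∉Γ = cong₂ _⊗_ ([/]-unused sA X∉Γ) ([/]-unused sB X∉Γ)
[/]-unused {X = X} (sμ {X = Y} sA) X∉Γ with Y ≟ X
... | yes Y≡X = [/]-μ-shadowed Y≡X
... | no  Y≢X = trans ([/]-μ Y≢X)
                      (cong (μ Y) ([/]-unused sA λ { (here X≡Y) → Y≢X (sym X≡Y) ; (there m) → X∉Γ m }))
[/]-unused {X = X} (svar {X = Y} Y∈Γ) X∉Γ with Y ≟ X
... | yes refl = ⊥-elim (X∉Γ Y∈Γ)
... | no  Y≢X  = [/]-tvar-miss Y≢X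

[/]-closed : Closed A → A [ B / X ] ≡ A
[/]-closed sA = [/]-unused sA λ ()

Scoped-[/] : Scoped (X ∷ Γ) A → Closed B → Scoped Γ (A [ B / X ])
Scoped-[/] s𝟙 sB = s𝟙
Scoped-[/] (s⊕ sA₁ sA₂) sB = s⊕ (Scoped-[/] sA₁ sB) (Scoped-[/] sA₂ sB)
Scoped-[/] (s⊗ sA₁ sA₂) sB = s⊗ (Scoped-[/] sA₁ sB) (Scoped-[/] sA₂ sB)
Scoped-[/] {X} {Γ} (sμ {X = Y} sA) sB with Y ≟ X
... | yes refl = subst (Scoped _) (sym ([/]-μ-shadowed refl)) (sμ (Scoped-weaken contract sA))
  where
  contract : Y ∷ Y ∷ Γ ⊆ Y ∷ Γ
  contract (here e)         = here e
  contract (there (here e))  = here e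
  contract (there (there m)) = there m
... | no  Y≢X  = subst (Scoped _) (sym ([/]-μ Y≢X)) (sμ (Scoped-[/] (Scoped-weaken exchange sA) sB))
  where
  exchange : Y ∷ X ∷ Γ ⊆ X ∷ Y ∷ Γ
  exchange (here e)          = there (here e)
  exchange (there (here e))  = here e
  exchange (there (there m)) = there (there m)
Scoped-[/] {X} (svar {X = Y} Y∈XΓ) sB with Y ≟ X | Y∈XΓ
... | yes Y≡X | _            = subst (Scoped _) (sym ([/]-tvar-hit Y≡X)) (Scoped-weaken (λ ()) sB)
... | no  Y≢X | here Y≡X     = ⊥-elim (Y≢X Y≡X)
... | no  Y≢X | there Y∈Γ    = subst (Scoped _) (sym ([/]-tvar-miss Y≢X)) (svar Y∈Γ)

-- The unfolding of μ tyVar body, with isoVar the fix-bound variable answering it.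
record Binding : Set where
  constructor bind
  field
    tyVar  : ℕ
    isoVar : IsoVar
    body   : Ty

  recType : Ty
  recType = μ tyVar body

open Binding

Env : Set
Env = List Binding

keys : Env → List ℕ
keys = map tyVar

isoEnv : Env → DupEnv
isoEnv = map (λ b → tyVar b , isoVar b)

DupType : Ty → ITy
DupType T = T ↔ (T ⊗ T)

isoCtx : Env → ICtx
isoCtx = map (λ b → isoVar b , DupType (recType b))

-- The head of the environment is the most recent unfolding, hence applied last.
_⟪_⟫ : Ty → Env → Ty
A ⟪ []    ⟫ = A
A ⟪ b ∷ σ ⟫ = (A ⟪ σ ⟫) [ recType b / tyVar b ]

Fresh : ℕ → Env → Set
Fresh n σ = All (λ b → isoVar b < n) σ

data WfEnv : Env → Set where
  []     : WfEnv []
  extend : ∀ {b σ} → Closed (recType b) → Fresh (isoVar b) σ → WfEnv σ → WfEnv (b ∷ σ)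

private
  variable
    σ : Env

Fresh-mono : n ≤ m → Fresh n σ → Fresh m σ
Fresh-mono n≤m = All.map (λ φ<n → ≤-trans φ<n n≤m)

isoCtx-lookup : ∀ {b} → WfEnv σ → b ∈ σ → Lookup (isoCtx σ) (isoVar b) (DupType (recType b))
isoCtx-lookup (extend _ _ _)      (here refl) = here
isoCtx-lookup (extend _ fresh wf) (there b∈σ) =
  there (<⇒≢ (All.lookup fresh b∈σ)) (isoCtx-lookup wf b∈σ)

keys-∉⇒isoEnv-∉ : X ∉ keys σ → ¬ Any (λ q → proj₁ q ≡ X) (isoEnv σ)
keys-∉⇒isoEnv-∉ {σ = b ∷ σ} X∉ (here X≡)  = X∉ (here (sym X≡))
keys-∉⇒isoEnv-∉ {σ = b ∷ σ} X∉ (there q) = keys-∉⇒isoEnv-∉ (X∉ ∘ there) q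

⟪⟫-𝟙 : ∀ σ → 𝟙 ⟪ σ ⟫ ≡ 𝟙
⟪⟫-𝟙 []      = refl
⟪⟫-𝟙 (b ∷ σ) rewrite ⟪⟫-𝟙 σ = refl

⟪⟫-⊕ : ∀ σ → (A ⊕ B) ⟪ σ ⟫ ≡ (A ⟪ σ ⟫) ⊕ (B ⟪ σ ⟫)
⟪⟫-⊕ []      = refl
⟪⟫-⊕ {A = A} {B = B} (b ∷ σ) rewrite ⟪⟫-⊕ {A} {B} σ = refl

⟪⟫-⊗ : ∀ σ → (A ⊗ B) ⟪ σ ⟫ ≡ (A ⟪ σ ⟫) ⊗ (B ⟪ σ ⟫)
⟪⟫-⊗ []      = refl
⟪⟫-⊗ {A = A} {B = B} (b ∷ σ) rewrite ⟪⟫-⊗ {A} {B} σ = refl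

⟪⟫-μ : ∀ σ → Y ∉ keys σ → μ Y A ⟪ σ ⟫ ≡ μ Y (A ⟪ σ ⟫)
⟪⟫-μ []      Y∉ = refl
⟪⟫-μ {Y = Y} {A = A} (b ∷ σ) Y∉ rewrite ⟪⟫-μ {Y} {A} σ (Y∉ ∘ there) = [/]-μ (Y∉ ∘ here)

⟪⟫-tvar-∉ : ∀ σ → X ∉ keys σ → tvar X ⟪ σ ⟫ ≡ tvar X
⟪⟫-tvar-∉ []      X∉ = refl
⟪⟫-tvar-∉ (b ∷ σ) X∉ rewrite ⟪⟫-tvar-∉ σ (X∉ ∘ there) = [/]-tvar-miss (X∉ ∘ here)

WfEnv-closed : ∀ {b} → WfEnv σ → b ∈ σ → Closed (recType b)
WfEnv-closed (extend cl _ _) (here refl) = cl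
WfEnv-closed (extend _ _ wf) (there b∈σ) = WfEnv-closed wf b∈σ

-- The earliest unfolding of X wins: its result is closed, so later ones leave it alone.
⟪⟫-tvar-∈ : ∀ σ → WfEnv σ → X ∈ keys σ →
            Σ IsoVar λ φ → Σ Ty λ E → bind X φ E ∈ σ × tvar X ⟪ σ ⟫ ≡ μ X E
⟪⟫-tvar-∈ {X = X} (b ∷ σ) (extend _ _ wf) X∈ with X ∈? keys σ | X∈
... | yes X∈σ | _ =
  let φ , E , b′∈σ , X⟪σ⟫≡ = ⟪⟫-tvar-∈ σ wf X∈σ
  in  φ , E , there b′∈σ
        , trans (cong (_[ recType b / tyVar b ]) X⟪σ⟫≡) ([/]-closed (WfEnv-closed wf b′∈σ))
... | no X∉σ | here refl = isoVar b , body b , here refl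
                          , trans (cong (_[ recType b / X ]) (⟪⟫-tvar-∉ σ X∉σ)) ([/]-tvar-hit refl)
... | no X∉σ | there X∈σ = ⊥-elim (X∉σ X∈σ)

Scoped-⟪⟫ : ∀ σ → WfEnv σ → Scoped (Γ ++ keys σ) A → Scoped Γ (A ⟪ σ ⟫)
Scoped-⟪⟫ {Γ} []      []               sA = subst (λ Δ → Scoped Δ _) (++-identityʳ Γ) sA
Scoped-⟪⟫ {Γ} (b ∷ σ) (extend cl _ wf) sA =
  Scoped-[/] (Scoped-⟪⟫ σ wf (Scoped-weaken (∈-resp-↭ (shift (tyVar b) Γ (keys σ))) sA)) cl

dup𝟙 : Iso
dup𝟙 = clauses ((unit , val ⟨ unit , unit ⟩) ∷ [])

dup⊗ : ℕ → Iso → Iso → Iso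
dup⊗ n ωA ωB =
  clauses ((⟨ var n , var (1 + n) ⟩ ,
            elet (ppair (pvar (2 + n)) (pvar (3 + n))) ωA (pvar n)
             (elet (ppair (pvar (4 + n)) (pvar (5 + n))) ωB (pvar (1 + n))
               (val ⟨ ⟨ var (2 + n) , var (4 + n) ⟩ , ⟨ var (3 + n) , var (5 + n) ⟩ ⟩))) ∷ [])

dup⊕ : ℕ → Iso → Iso → Iso
dup⊕ n ωA ωB =
  clauses ((inl (var n) ,
            elet (ppair (pvar (1 + n)) (pvar (2 + n))) ωA (pvar n)
              (val ⟨ inl (var (1 + n)) , inl (var (2 + n)) ⟩)) ∷
           (inr (var (3 + n)) ,
            elet (ppair (pvar (4 + n)) (pvar (5 + n))) ωB (pvar (3 + n))
              (val ⟨ inr (var (4 + n)) , inr (var (5 + n)) ⟩)) ∷ [])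

dupμ : ℕ → Iso → Iso
dupμ n ω =
  fix n (clauses ((fold (var (1 + n)) ,
                   elet (ppair (pvar (2 + n)) (pvar (3 + n))) ω (pvar (1 + n))
                     (val ⟨ fold (var (2 + n)) , fold (var (3 + n)) ⟩)) ∷ []))

dupCall : ℕ → IsoVar → Iso
dupCall n φ =
  clauses ((var n ,
            elet (ppair (pvar (1 + n)) (pvar (2 + n))) (ivar φ) (pvar n)
              (val ⟨ var (1 + n) , var (2 + n) ⟩)) ∷ [])

unique₂ : ∀ a b → a ≢ b → Unique (a + n ∷ b + n ∷ [])
unique₂ a b a≢b = (offset-≢ a b a≢b ∷ []) ∷ [] ∷ []

⊢dup𝟙 : Ψ ⊢ω dup𝟙 ∶ DupType 𝟙
⊢dup𝟙 = tclauses (tclause [] tunit (tval (tpair [] tunit tunit)) ∷ []) ([] ∷ []) ([] ∷ [])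

⊢dup⊗ : ∀ n {ωA ωB} → Ψ ⊢ω ωA ∶ DupType A → Ψ ⊢ω ωB ∶ DupType B → Ψ ⊢ω dup⊗ n ωA ωB ∶ DupType (A ⊗ B)
⊢dup⊗ n ⊢ωA ⊢ωB =
  tclauses
    (tclause (unique₂ 0 1 λ ()) (tpair (left (right [])) tvarr tvarr)
      (tlet (left (right [])) ⊢ωA tvarr (tpair (left (right [])) tvarr tvarr)
        (left (right (right [])))
        ((offset-≢ 1 2 (λ ()) ∷ offset-≢ 1 3 (λ ()) ∷ []) ∷ (offset-≢ 2 3 (λ ()) ∷ []) ∷ [] ∷ [])
        (tlet (left (right (right []))) ⊢ωB tvarr (tpair (left (right [])) tvarr tvarr)
          (left (right (left (right []))))
          ((offset-≢ 2 4 (λ ()) ∷ offset-≢ 2 3 (λ ()) ∷ offset-≢ 2 5 (λ ()) ∷ [])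
             ∷ (offset-≢ 4 3 (λ ()) ∷ offset-≢ 4 5 (λ ()) ∷ []) ∷ (offset-≢ 3 5 (λ ()) ∷ []) ∷ [] ∷ [])
          (tval (tpair (left (left (right (right []))))
                  (tpair (left (right [])) tvarr tvarr)
                  (tpair (left (right [])) tvarr tvarr)))))
     ∷ [])
    ([] ∷ []) ([] ∷ [])

⊢dup⊕ : ∀ n {ωA ωB} → Ψ ⊢ω ωA ∶ DupType A → Ψ ⊢ω ωB ∶ DupType B → Ψ ⊢ω dup⊕ n ωA ωB ∶ DupType (A ⊕ B)
⊢dup⊕ n ⊢ωA ⊢ωB =
  tclauses
    (tclause ([] ∷ []) (tinl tvarr)
       (tlet (left []) ⊢ωA tvarr (tpair (left (right [])) tvarr tvarr) (right (right []))
         (unique₂ 1 2 λ ()) (tval (tpair (left (right [])) (tinl tvarr) (tinl tvarr))))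
     ∷ tclause ([] ∷ []) (tinr tvarr)
       (tlet (left []) ⊢ωB tvarr (tpair (left (right [])) tvarr tvarr) (right (right []))
         (unique₂ 4 5 λ ()) (tval (tpair (left (right [])) (tinr tvarr) (tinr tvarr))))
     ∷ [])
    ((lr ∷ []) ∷ [] ∷ [])
    ((clet (cval (cpairₗ lr)) ∷ []) ∷ [] ∷ [])

⊢dupμ : ∀ n {ω} → ((n , DupType (μ X D)) ∷ Ψ) ⊢ω ω ∶ DupType (D [ μ X D / X ]) →
        Ψ ⊢ω dupμ n ω ∶ DupType (μ X D)
⊢dupμ n ⊢ω =
  tfix (tclauses
    (tclause ([] ∷ []) (tfold tvarr)
      (tlet (left []) ⊢ω tvarr (tpair (left (right [])) tvarr tvarr) (right (right []))
        (unique₂ 2 3 λ ()) (tval (tpair (left (right [])) (tfold tvarr) (tfold tvarr))))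
     ∷ [])
    ([] ∷ []) ([] ∷ []))

⊢dupCall : ∀ n → Lookup Ψ φ (DupType A) → Ψ ⊢ω dupCall n φ ∶ DupType A
⊢dupCall n φ∶A =
  tclauses
    (tclause ([] ∷ []) tvarr
      (tlet (left []) (tivar φ∶A) tvarr (tpair (left (right [])) tvarr tvarr) (right (right []))
        (unique₂ 1 2 λ ()) (tval (tpair (left (right [])) tvarr tvarr)))
     ∷ [])
    ([] ∷ []) ([] ∷ [])

Duplicator : DupEnv → ICtx → ℕ → Ty → Set
Duplicator S Ψ n T = Σ Iso λ ω → Σ ℕ λ m → Dup S T n ω m × n ≤ m × Ψ ⊢ω ω ∶ DupType T

Duplicator-⊕ : Duplicator S Ψ (6 + n) A × (∀ {m} → 6 + n ≤ m → Duplicator S Ψ m B) →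
               Duplicator S Ψ n (A ⊕ B)
Duplicator-⊕ {n = n} ((ωA , m₁ , dupA , n≤m₁ , ⊢ωA) , dupFrom) with dupFrom n≤m₁
... | ωB , m₂ , dupB , m₁≤m₂ , ⊢ωB =
  dup⊕ n ωA ωB , m₂ , d⊕ dupA dupB , ≤-trans (m≤n+m n 6) (≤-trans n≤m₁ m₁≤m₂) , ⊢dup⊕ n ⊢ωA ⊢ωB

Duplicator-⊗ : Duplicator S Ψ (6 + n) A × (∀ {m} → 6 + n ≤ m → Duplicator S Ψ m B) →
               Duplicator S Ψ n (A ⊗ B)
Duplicator-⊗ {n = n} ((ωA , m₁ , dupA , n≤m₁ , ⊢ωA) , dupFrom) with dupFrom n≤m₁
... | ωB , m₂ , dupB , m₁≤m₂ , ⊢ωB =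
  dup⊗ n ωA ωB , m₂ , d⊗ dupA dupB , ≤-trans (m≤n+m n 6) (≤-trans n≤m₁ m₁≤m₂) , ⊢dup⊗ n ⊢ωA ⊢ωB

Duplicator-μ : ¬ Any (λ q → proj₁ q ≡ X) S →
               Duplicator ((X , n) ∷ S) ((n , DupType (μ X D)) ∷ Ψ) (4 + n) (D [ μ X D / X ]) →
               Duplicator S Ψ n (μ X D)
Duplicator-μ {n = n} X∉S (ω , m , dup , 4+n≤m , ⊢ω) =
  dupμ n ω , m , dμnew X∉S dup , ≤-trans (m≤n+m n 4) 4+n≤m , ⊢dupμ n ⊢ω

mutual
  dup-exists : ∀ σ {D} n → WfEnv σ → Fresh n σ → Scoped (keys σ) D →
               Unique (binders D) → All (_∉ keys σ) (binders D) →
               Duplicator (isoEnv σ) (isoCtx σ) n (D ⟪ σ ⟫)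
  dup-exists σ n wf fresh s𝟙 _ _ =
    subst (Duplicator _ _ n) (sym (⟪⟫-𝟙 σ)) (dup𝟙 , n , d𝟙 , ≤-refl , ⊢dup𝟙)
  dup-exists σ n wf fresh (s⊕ sA sB) distinct new =
    subst (Duplicator _ _ n) (sym (⟪⟫-⊕ σ)) (Duplicator-⊕ (dup-exists-pair σ n wf fresh sA sB distinct new))
  dup-exists σ n wf fresh (s⊗ sA sB) distinct new =
    subst (Duplicator _ _ n) (sym (⟪⟫-⊗ σ)) (Duplicator-⊗ (dup-exists-pair σ n wf fresh sA sB distinct new))
  dup-exists σ n wf fresh (sμ {X = Y} {A = E} sE) (Y∉E ∷ distinct) (Y∉σ ∷ new) =
    subst (Duplicator _ _ n) (sym (⟪⟫-μ σ Y∉σ))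
      (Duplicator-μ (keys-∉⇒isoEnv-∉ Y∉σ)
        (dup-exists (bind Y n (E ⟪ σ ⟫) ∷ σ) (4 + n)
          (extend (sμ (Scoped-⟪⟫ σ wf sE)) fresh wf)
          (m≤n+m (1 + n) 3 ∷ Fresh-mono (m≤n+m n 4) fresh)
          sE distinct
          (All.zipWith (uncurry ∉-∷) (Y∉E , new))))
  dup-exists σ n wf fresh (svar X∈σ) _ _
    with ⟪⟫-tvar-∈ σ wf X∈σ
  ... | φ , E , b∈σ , X⟪σ⟫≡ =
    subst (Duplicator _ _ n) (sym X⟪σ⟫≡)
      (dupCall n φ , 3 + n , dμold (∈-map⁺ _ b∈σ) , m≤n+m n 3 , ⊢dupCall n (isoCtx-lookup wf b∈σ))

  dup-exists-pair : ∀ σ {A B} n → WfEnv σ → Fresh n σ → Scoped (keys σ) A → Scoped (keys σ) B →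
                    Unique (binders A ++ binders B) → All (_∉ keys σ) (binders A ++ binders B) →
                    Duplicator (isoEnv σ) (isoCtx σ) (6 + n) (A ⟪ σ ⟫)
                    × (∀ {m} → 6 + n ≤ m → Duplicator (isoEnv σ) (isoCtx σ) m (B ⟪ σ ⟫))
  dup-exists-pair σ {A} n wf fresh sA sB distinct new =
    let distinctA , distinctB = Unique-++⁻ (binders A) distinct in
    dup-exists σ (6 + n) wf (Fresh-mono (m≤n+m n 6) fresh) sA distinctA (All.++⁻ˡ (binders A) new) ,
    λ {m} 6+n≤m → dup-exists σ m wf (Fresh-mono (≤-trans (m≤n+m n 6) 6+n≤m) fresh) sB distinctB
                               (All.++⁻ʳ (binders A) new)

data UniqueKeys : DupEnv → Set where
  []  : UniqueKeys []
  _∷_ : ¬ Any (λ q → proj₁ q ≡ X) S → UniqueKeys S → UniqueKeys ((X , φ) ∷ S)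

∈⇒key-∈ : (X , φ) ∈ S → Any (λ q → proj₁ q ≡ X) S
∈⇒key-∈ = Any.map (sym ∘ cong proj₁)

UniqueKeys-lookup : ∀ {φ′} → UniqueKeys S → (X , φ) ∈ S → (X , φ′) ∈ S → φ ≡ φ′
UniqueKeys-lookup _              (here refl) (here refl) = refl
UniqueKeys-lookup (X∉S ∷ _)      (here refl) (there m′)  = ⊥-elim (X∉S (∈⇒key-∈ m′))
UniqueKeys-lookup (X∉S ∷ _)      (there m)   (here refl) = ⊥-elim (X∉S (∈⇒key-∈ m))
UniqueKeys-lookup (_ ∷ unique)   (there m)   (there m′)  = UniqueKeys-lookup unique m m′

Dup-deterministic : ∀ {ω ω′ m m′} → UniqueKeys S → Dup S A n ω m → Dup S A n ω′ m′ → ω ≡ ω′ × m ≡ m′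
Dup-deterministic uk d𝟙 d𝟙 = refl , refl
Dup-deterministic uk (d⊗ dA dB) (d⊗ dA′ dB′) with Dup-deterministic uk dA dA′
... | refl , refl with Dup-deterministic uk dB dB′
... | refl , refl = refl , refl
Dup-deterministic uk (d⊕ dA dB) (d⊕ dA′ dB′) with Dup-deterministic uk dA dA′
... | refl , refl with Dup-deterministic uk dB dB′
... | refl , refl = refl , refl
Dup-deterministic uk (dμnew X∉S d) (dμnew X∉S′ d′) with Dup-deterministic (X∉S ∷ uk) d d′
... | refl , refl = refl , refl
Dup-deterministic uk (dμnew X∉S _) (dμold X∈S) = ⊥-elim (X∉S (∈⇒key-∈ X∈S))
Dup-deterministic uk (dμold X∈S) (dμnew X∉S _) = ⊥-elim (X∉S (∈⇒key-∈ X∈S))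
Dup-deterministic uk (dμold X∈S) (dμold X∈S′) with UniqueKeys-lookup uk X∈S X∈S′
... | refl = refl , refl

mainTheorem9 : (A : Ty) → Closed A → DistinctBinders A →
    Σ Iso (λ ω → Σ ℕ (λ m →
      Dup [] A 0 ω m
      × (∀ ω' m' → Dup [] A 0 ω' m' → ω' ≡ ω)
      × ([] ⊢ω ω ∶ (A ↔ (A ⊗ A)))))
mainTheorem9 A closed distinct
  with dup-exists [] 0 [] [] closed distinct (All.tabulate λ _ ())
... | ω , m , dup , _ , ⊢ω =
  ω , m , dup , (λ ω′ m′ dup′ → proj₁ (Dup-deterministic [] dup′ dup)) , ⊢ω
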